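{- Let $G$ be a rectangular grid graph with $w$ vertex columns and $h$ vertex rows, with $90$-degree turns costing $1$ and straight traversals costing $0$. If at least one of $w$ and $h$ is even, then every threading of $G$ has at least $2\lceil w/2\rceil\cdot 2\lceil h/2\rceil$ turns.
   Context: A rectangular grid graph with $w$ vertex columns and $h$ vertex rows is the lattice graph on a $w$ by $h$ array of vertices, adjacent vertices being horizontal or vertical neighbours. A turn at $v$ is an unordered pair of distinct edges incident to $v$, costing $1$ if the edges are perpendicular and $0$ if collinear; the number of turns of a closed walk is the sum of costs of its consecutive pairs of edges, cyclically. The junction graph $J(v)$ induced by a closed walk at vertex $v$ has one vertex for each edge incident to $v$, and an edge between two of these vertices every time the walk visits $v$ immediately in between traversing the corresponding two edges. A threading is a closed walk that traverses every edge at least once, has no U-turns (never traverses the same edge twice in immediate succession, cyclically), and induces a connected junction graph at every vertex. -}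

module Defs where

open import Data.Nat using (ℕ; zero; suc; _+_; _*_; _<_; ⌈_/2⌉)
open import Data.Fin using (Fin; toℕ)
open import Data.Product using (Σ; _×_; _,_; ∃; ∃-syntax)
open import Data.Sum using (_⊎_)
open import Relation.Binary.PropositionalEquality using (_≡_; _≢_)
open import Relation.Binary.Construct.Closure.ReflexiveTransitive using (Star)
open import Relation.Nullary using (¬_; yes; no)
open import Data.Nat using (_≟_)

Vertex : ℕ → ℕ → Set
Vertex w h = Fin w × Fin h

HorizAdj : ∀ {w h} → Vertex w h → Vertex w h → Set
HorizAdj (x , y) (x' , y') = toℕ y ≡ toℕ y' × (suc (toℕ x) ≡ toℕ x' ⊎ suc (toℕ x') ≡ toℕ x)

VertAdj : ∀ {w h} → Vertex w h → Vertex w h → Set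
VertAdj (x , y) (x' , y') = toℕ x ≡ toℕ x' × (suc (toℕ y) ≡ toℕ y' ⊎ suc (toℕ y') ≡ toℕ y)

Adj : ∀ {w h} → Vertex w h → Vertex w h → Set
Adj u v = HorizAdj u v ⊎ VertAdj u v

-- A closed walk of length n (n edges), given as an n-periodic sequence of vertices
-- p 0, p 1, ..., where the i-th edge (i < n) joins p i and p (suc i).
record ClosedWalk (w h : ℕ) : Set where
  field
    len      : ℕ
    pos      : ℕ → Vertex w h
    periodic : ∀ i → pos (i + len) ≡ pos i
    steps    : ∀ i → Adj (pos i) (pos (suc i))
open ClosedWalk public

TraversesAt : ∀ {w h} (W : ClosedWalk w h) → ℕ → Vertex w h → Vertex w h → Set
TraversesAt W i u v =
  (pos W i ≡ u × pos W (suc i) ≡ v) ⊎ (pos W i ≡ v × pos W (suc i) ≡ u)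

CoversAllEdges : ∀ {w h} → ClosedWalk w h → Set
CoversAllEdges {w} {h} W =
  ∀ (u v : Vertex w h) → Adj u v → ∃[ i ] (i < len W × TraversesAt W i u v)

-- No U-turns: the same edge is never traversed twice in immediate succession
-- (cyclically); in a simple graph this means pos (i+2) ≠ pos i.
NoUTurns : ∀ {w h} → ClosedWalk w h → Set
NoUTurns W = ∀ i → pos W (suc (suc i)) ≢ pos W i

-- Junction graph J(v): its vertices are the edges incident to v, each represented
-- by its other endpoint a (with Adj v a).  Each visit of the walk to v at time
-- suc i (between traversing the edges {p i, v} and {v, p (i+2)}) contributes an
-- edge between those two edges.
JLink : ∀ {w h} (W : ClosedWalk w h) → Vertex w h → Vertex w h → Vertex w h → Set
JLink W v a b = ∃[ i ] (i < len W × pos W (suc i) ≡ v ×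
  ((pos W i ≡ a × pos W (suc (suc i)) ≡ b) ⊎ (pos W i ≡ b × pos W (suc (suc i)) ≡ a)))

JunctionConnected : ∀ {w h} → ClosedWalk w h → Vertex w h → Set
JunctionConnected {w} {h} W v =
  ∀ (a b : Vertex w h) → Adj v a → Adj v b → Star (JLink W v) a b

Threading : ∀ {w h} → ClosedWalk w h → Set
Threading {w} {h} W =
  CoversAllEdges W × NoUTurns W × (∀ (v : Vertex w h) → JunctionConnected W v)

rowOf : ∀ {w h} → Vertex w h → ℕ
rowOf (_ , y) = toℕ y

-- Cost of the turn at pos (suc i) between edges i and suc i:
-- (a step is horizontal iff it stays in the same row)
-- 1 if perpendicular (one horizontal, one vertical), 0 if collinear.
turnCost : ∀ {w h} → ClosedWalk w h → ℕ → ℕ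
turnCost W i with rowOf (pos W i) ≟ rowOf (pos W (suc i)) | rowOf (pos W (suc i)) ≟ rowOf (pos W (suc (suc i)))
... | yes _ | yes _ = 0
... | no _  | no _  = 0
... | yes _ | no _  = 1
... | no _  | yes _ = 1

sumBelow : ℕ → (ℕ → ℕ) → ℕ
sumBelow zero    f = 0
sumBelow (suc n) f = sumBelow n f + f n

turns : ∀ {w h} → ClosedWalk w h → ℕ
turns W = sumBelow (len W) (turnCost W)

-- Every vertex of a threading is visited at least once with a turn: its junction
-- graph is connected, so some visit passes from a horizontal to a vertical edge.
-- Say w is even and split the turns by column.  Along the walk, the turns in column x
-- are exactly the visits where the walk switches between a vertical step (which stays
-- in column x) and a horizontal one, so counting the vertical steps of the column at
-- both ends shows that column x has an even number of turns.  As its h vertices all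
-- carry a turn, column x has at least 2⌈h/2⌉ turns, and the w columns give the bound.
-- For h even the same argument runs over rows.
module Submission where

open import Defs
open import Data.Bool using (Bool; true; false; not; _xor_; T)
open import Data.Bool.Properties using (not-distribˡ-xor; not-distribʳ-xor; not-involutive; xor-inverseˡ)
open import Data.Nat
open import Data.Nat.Properties
open import Algebra.Properties.CommutativeSemigroup +-commutativeSemigroup using (interchange)
open import Data.Nat.Divisibility using (_∣_; divides; ∣-trans; m∣m*n; n∣m*n; ∣m∣n⇒∣m+n; ∣m+n∣m⇒∣n)
open import Data.Fin using (Fin; toℕ; fromℕ<; inject₁) renaming (zero to fzero; suc to fsuc)
open import Data.Fin.Properties using (toℕ<n; toℕ-fromℕ<; toℕ-inject₁)
open import Data.Product
open import Data.Sum using (_⊎_; inj₁; inj₂)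
open import Data.Empty using (⊥; ⊥-elim)
open import Function using (_∘_)
open import Relation.Nullary using (¬_; yes; no; does)
open import Relation.Nullary.Decidable using (dec-true; dec-false)
open import Relation.Unary using (Pred; Decidable)
open import Relation.Binary.PropositionalEquality
open import Relation.Binary.Construct.Closure.ReflexiveTransitive using (Star; ε; _◅_)

sumBelow-cong : ∀ n {f g : ℕ → ℕ} → (∀ i → f i ≡ g i) → sumBelow n f ≡ sumBelow n g
sumBelow-cong zero    f≡g = refl
sumBelow-cong (suc n) f≡g = cong₂ _+_ (sumBelow-cong n f≡g) (f≡g n)

sumBelow-+ : ∀ n (f g : ℕ → ℕ) → sumBelow n (λ i → f i + g i) ≡ sumBelow n f + sumBelow n g
sumBelow-+ zero    f g = refl
sumBelow-+ (suc n) f g = trans (cong (_+ (f n + g n)) (sumBelow-+ n f g))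
                               (interchange (sumBelow n f) (sumBelow n g) (f n) (g n))

sumBelow-zero : ∀ n → sumBelow n (λ _ → 0) ≡ 0
sumBelow-zero zero    = refl
sumBelow-zero (suc n) = trans (+-identityʳ _) (sumBelow-zero n)

sumBelow-swap : ∀ n m (f : ℕ → ℕ → ℕ) →
  sumBelow n (λ i → sumBelow m (f i)) ≡ sumBelow m (λ j → sumBelow n (λ i → f i j))
sumBelow-swap zero    m f = sym (sumBelow-zero m)
sumBelow-swap (suc n) m f = trans (cong (_+ sumBelow m (f n)) (sumBelow-swap n m f))
                                  (sym (sumBelow-+ m (λ j → sumBelow n (λ i → f i j)) (f n)))

sumBelow-rotate : ∀ n (g : ℕ → ℕ) → g n ≡ g 0 → sumBelow n (g ∘ suc) ≡ sumBelow n g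
sumBelow-rotate n g gn≡g0 = +-cancelʳ-≡ _ _ _ (trans (shift n) (cong (sumBelow n g +_) gn≡g0))
  where
  shift : ∀ n → sumBelow n (g ∘ suc) + g 0 ≡ sumBelow n g + g n
  shift zero    = refl
  shift (suc n) = begin
    sumBelow n (g ∘ suc) + g (suc n) + g 0   ≡⟨ +-assoc (sumBelow n (g ∘ suc)) _ _ ⟩
    sumBelow n (g ∘ suc) + (g (suc n) + g 0) ≡⟨ cong (sumBelow n (g ∘ suc) +_) (+-comm (g (suc n)) (g 0)) ⟩
    sumBelow n (g ∘ suc) + (g 0 + g (suc n)) ≡⟨ +-assoc (sumBelow n (g ∘ suc)) _ _ ⟨
    sumBelow n (g ∘ suc) + g 0 + g (suc n)   ≡⟨ cong (_+ g (suc n)) (shift n) ⟩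
    sumBelow n g + g n + g (suc n)           ∎
    where open ≡-Reasoning

sumBelow-∣ : ∀ {d} n (f : ℕ → ℕ) → (∀ i → d ∣ f i) → d ∣ sumBelow n f
sumBelow-∣ zero    f d∣f = divides 0 refl
sumBelow-∣ (suc n) f d∣f = ∣m∣n⇒∣m+n (sumBelow-∣ n f d∣f) (d∣f n)

≤-sumBelow : ∀ n (f : ℕ → ℕ) {i} → i < n → f i ≤ sumBelow n f
≤-sumBelow (suc n) f {i} i<1+n with i ≟ n
... | yes refl = m≤n+m (f i) (sumBelow i f)
... | no  i≢n  = ≤-trans (≤-sumBelow n f (≤∧≢⇒< (≤-pred i<1+n) i≢n)) (m≤m+n _ _)

n*c≤sumBelow : ∀ n c (f : ℕ → ℕ) → (∀ i → i < n → c ≤ f i) → n * c ≤ sumBelow n f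
n*c≤sumBelow zero    c f c≤f = z≤n
n*c≤sumBelow (suc n) c f c≤f = begin
  c + n * c          ≡⟨ +-comm c (n * c) ⟩
  n * c + c          ≤⟨ +-mono-≤ (n*c≤sumBelow n c f (λ i → c≤f i ∘ m<n⇒m<1+n)) (c≤f n ≤-refl) ⟩
  sumBelow n f + f n ∎
  where open ≤-Reasoning

bit : Bool → ℕ
bit false = 0
bit true  = 1

δ : ℕ → ℕ → ℕ
δ m n = bit (does (m ≟ n))

δ-refl : ∀ n → δ n n ≡ 1
δ-refl n = cong bit (dec-true (n ≟ n) refl)

δ-≢ : ∀ {m n} → m ≢ n → δ m n ≡ 0
δ-≢ {m} {n} m≢n = cong bit (dec-false (m ≟ n) m≢n)

sumBelow-δ : ∀ n {k} a → k < n → sumBelow n (λ x → δ k x * a) ≡ a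
sumBelow-δ (suc n) {k} a k<1+n with k ≟ n
... | yes refl = cong₂ _+_ (outside n ≤-refl) (trans (cong (_* a) (δ-refl n)) (*-identityˡ a))
  where
  outside : ∀ m → m ≤ k → sumBelow m (λ x → δ k x * a) ≡ 0
  outside zero    _   = refl
  outside (suc m) m<k = cong₂ _+_ (outside m (<⇒≤ m<k)) (cong (_* a) (δ-≢ (<⇒≢ m<k ∘ sym)))
... | no k≢n = begin
  sumBelow n (λ x → δ k x * a) + δ k n * a ≡⟨ cong₂ _+_ (sumBelow-δ n a (≤∧≢⇒< (≤-pred k<1+n) k≢n)) (cong (_* a) (δ-≢ k≢n)) ⟩
  a + 0                                    ≡⟨ +-identityʳ a ⟩
  a                                        ∎
  where open ≡-Reasoning

sumBelow-partition : ∀ L N (κ f : ℕ → ℕ) → (∀ i → κ i < N) →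
  sumBelow L f ≡ sumBelow N (λ x → sumBelow L (λ i → δ (κ i) x * f i))
sumBelow-partition L N κ f κ<N =
  trans (sumBelow-cong L (λ i → sym (sumBelow-δ N (f i) (κ<N i))))
        (sumBelow-swap L N (λ i x → δ (κ i) x * f i))

bit-xor : ∀ p q → 2 * (bit p * bit q) + bit (p xor q) ≡ bit p + bit q
bit-xor false false = refl
bit-xor false true  = refl
bit-xor true  false = refl
bit-xor true  true  = refl

not-xor-not : ∀ p q → not p xor not q ≡ p xor q
not-xor-not p q = begin
  not p xor not q     ≡⟨ not-distribˡ-xor p (not q) ⟨
  not (p xor not q)   ≡⟨ cong not (not-distribʳ-xor p q) ⟨
  not (not (p xor q)) ≡⟨ not-involutive (p xor q) ⟩
  p xor q             ∎
  where open ≡-Reasoning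

module _ {L : ℕ} (t a : ℕ → ℕ) where

  fibre : ℕ → ℕ
  fibre x = sumBelow L (λ i → δ (a (suc i)) x * t i)

  fibre-even : (s : ℕ → Bool) → (∀ i → t i ≡ bit (s i xor s (suc i))) →
    (∀ i → T (s i) → a (suc i) ≡ a i) → s L ≡ s 0 → a L ≡ a 0 → ∀ x → 2 ∣ fibre x
  fibre-even s t≡xor s-keeps-a s-periodic a-periodic x =
    ∣m+n∣m⇒∣n (subst (2 ∣_) (sym double-count) (m∣m*n G)) 2∣B
    where
    σ : ℕ → ℕ
    σ = bit ∘ s
    g : ℕ → ℕ
    g j = δ (a j) x * σ j
    G : ℕ
    G = sumBelow L g
    B : ℕ
    B = sumBelow L (λ i → δ (a (suc i)) x * (2 * (σ i * σ (suc i))))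

    2∣B : 2 ∣ B
    2∣B = sumBelow-∣ L _ (λ i → ∣-trans (m∣m*n (σ i * σ (suc i))) (n∣m*n (δ (a (suc i)) x)))

    entering : ∀ i → δ (a (suc i)) x * σ i ≡ g i
    entering i with s i in si
    ... | false = trans (*-zeroʳ (δ (a (suc i)) x)) (sym (*-zeroʳ (δ (a i) x)))
    ... | true  = cong (λ y → δ y x * 1) (s-keeps-a i (subst T (sym si) _))

    visit-count : ∀ i → δ (a (suc i)) x * (2 * (σ i * σ (suc i))) + δ (a (suc i)) x * t i ≡ g i + g (suc i)
    visit-count i = begin
      d * (2 * (σ i * σ (suc i))) + d * t i                 ≡⟨ *-distribˡ-+ d _ _ ⟨
      d * (2 * (σ i * σ (suc i)) + t i)                     ≡⟨ cong (λ c → d * (2 * (σ i * σ (suc i)) + c)) (t≡xor i) ⟩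
      d * (2 * (σ i * σ (suc i)) + bit (s i xor s (suc i))) ≡⟨ cong (d *_) (bit-xor (s i) (s (suc i))) ⟩
      d * (σ i + σ (suc i))                                 ≡⟨ *-distribˡ-+ d _ _ ⟩
      d * σ i + g (suc i)                                   ≡⟨ cong (_+ g (suc i)) (entering i) ⟩
      g i + g (suc i)                                       ∎
      where
      open ≡-Reasoning
      d : ℕ
      d = δ (a (suc i)) x

    -- Every s-step in the fibre is counted at both of its ends, and a visit
    -- turns exactly when its two bits σ differ.
    double-count : B + fibre x ≡ 2 * G
    double-count = begin
      B + fibre x                                  ≡⟨ sumBelow-+ L _ _ ⟨
      sumBelow L (λ i → _ + δ (a (suc i)) x * t i) ≡⟨ sumBelow-cong L visit-count ⟩
      sumBelow L (λ i → g i + g (suc i))           ≡⟨ sumBelow-+ L g (g ∘ suc) ⟩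
      G + sumBelow L (g ∘ suc)                     ≡⟨ cong (G +_) (sumBelow-rotate L g g-periodic) ⟩
      G + G                                        ≡⟨ cong (G +_) (+-identityʳ G) ⟨
      2 * G                                        ∎
      where
      open ≡-Reasoning
      g-periodic : g L ≡ g 0
      g-periodic = cong₂ (λ y b → δ y x * bit b) a-periodic s-periodic

  fibre-lowerBound : ∀ {M} (b : ℕ → ℕ) → (∀ i → b i < M) → ∀ x →
    (∀ y → y < M → ∃[ i ] i < L × a (suc i) ≡ x × b (suc i) ≡ y × t i ≡ 1) → M ≤ fibre x
  fibre-lowerBound {M} b b<M x turn-in-cell = begin
    M               ≡⟨ *-identityʳ M ⟨
    M * 1           ≤⟨ n*c≤sumBelow M 1 cell cell-nonempty ⟩
    sumBelow M cell ≡⟨ sumBelow-partition L M (b ∘ suc) _ (b<M ∘ suc) ⟨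
    fibre x         ∎
    where
    open ≤-Reasoning
    cell : ℕ → ℕ
    cell y = sumBelow L (λ i → δ (b (suc i)) y * (δ (a (suc i)) x * t i))

    cell-nonempty : ∀ y → y < M → 1 ≤ cell y
    cell-nonempty y y<M with turn-in-cell y y<M
    ... | i , i<L , refl , refl , ti≡1 =
      subst (_≤ cell y) (cong₂ _*_ (δ-refl y) (cong₂ _*_ (δ-refl x) ti≡1)) (≤-sumBelow L _ i<L)

2*⌈n/2⌉≡n : ∀ {n} → 2 ∣ n → 2 * ⌈ n /2⌉ ≡ n
2*⌈n/2⌉≡n (divides q refl) = begin
  2 * ⌈ q * 2 /2⌉ ≡⟨ cong (λ m → 2 * ⌈ m /2⌉) (trans (*-comm q 2) (cong (q +_) (+-identityʳ q))) ⟩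
  2 * ⌈ q + q /2⌉ ≡⟨ cong (2 *_) (n≡⌈n+n/2⌉ q) ⟨
  2 * q           ≡⟨ *-comm 2 q ⟩
  q * 2           ∎
  where open ≡-Reasoning

2*⌈m/2⌉≤n : ∀ {m n} → 2 ∣ n → m ≤ n → 2 * ⌈ m /2⌉ ≤ n
2*⌈m/2⌉≤n 2∣n m≤n = subst (_ ≤_) (2*⌈n/2⌉≡n 2∣n) (*-monoʳ-≤ 2 (⌈n/2⌉-mono m≤n))

turn-count-bound : ∀ {L N M} (t a b : ℕ → ℕ) (s : ℕ → Bool) →
  (∀ i → a i < N) → (∀ i → b i < M) →
  (∀ i → t i ≡ bit (s i xor s (suc i))) → (∀ i → T (s i) → a (suc i) ≡ a i) →
  s L ≡ s 0 → a L ≡ a 0 →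
  (∀ x y → x < N → y < M → ∃[ i ] i < L × a (suc i) ≡ x × b (suc i) ≡ y × t i ≡ 1) →
  N * (2 * ⌈ M /2⌉) ≤ sumBelow L t
turn-count-bound {L} {N} t a b s a<N b<M t≡xor s-keeps-a s-periodic a-periodic turn-in-cell =
  subst (_ ≤_) (sym (sumBelow-partition L N (a ∘ suc) t (a<N ∘ suc)))
    (n*c≤sumBelow N _ (fibre {L} t a) λ x x<N →
      2*⌈m/2⌉≤n (fibre-even {L} t a s t≡xor s-keeps-a s-periodic a-periodic x)
                (fibre-lowerBound {L} t a b b<M x (λ y → turn-in-cell x y x<N)))

Star-crossing : ∀ {a ℓ p} {A : Set a} {R : A → A → Set ℓ} {P : Pred A p} → Decidable P →
  ∀ {x y} → Star R x y → P x → ¬ P y → ∃₂ λ u v → R u v × P u × ¬ P v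
Star-crossing P? ε                      Px ¬Py = ⊥-elim (¬Py Px)
Star-crossing P? (_◅_ {j = z} xRz zR*y) Px ¬Py with P? z
... | yes Pz  = Star-crossing P? zR*y Pz ¬Py
... | no  ¬Pz = _ , z , xRz , Px , ¬Pz

columnOf : ∀ {w h} → Vertex w h → ℕ
columnOf (x , _) = toℕ x

Adj-sym : ∀ {w h} {u v : Vertex w h} → Adj u v → Adj v u
Adj-sym (inj₁ (row≡ , inj₁ e)) = inj₁ (sym row≡ , inj₂ e)
Adj-sym (inj₁ (row≡ , inj₂ e)) = inj₁ (sym row≡ , inj₁ e)
Adj-sym (inj₂ (col≡ , inj₁ e)) = inj₂ (sym col≡ , inj₂ e)
Adj-sym (inj₂ (col≡ , inj₂ e)) = inj₂ (sym col≡ , inj₁ e)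

adjacent-index : ∀ {n} → 2 ≤ n → (k : Fin n) → Σ[ j ∈ Fin n ] (suc (toℕ k) ≡ toℕ j ⊎ suc (toℕ j) ≡ toℕ k)
adjacent-index 2≤n fzero    = fromℕ< 2≤n , inj₁ (sym (toℕ-fromℕ< 2≤n))
adjacent-index _   (fsuc k) = inject₁ k , inj₂ (cong suc (toℕ-inject₁ k))

adjacent-≢ : ∀ {m n} → suc m ≡ n ⊎ suc n ≡ m → n ≢ m
adjacent-≢ (inj₁ 1+m≡n) n≡m = 1+n≢n (trans 1+m≡n n≡m)
adjacent-≢ (inj₂ 1+n≡m) n≡m = 1+n≢n (trans (cong suc (sym n≡m)) 1+n≡m)

module _ {w h : ℕ} (W : ClosedWalk w h) where

  horizontal : ℕ → Bool
  horizontal i = does (rowOf (pos W i) ≟ rowOf (pos W (suc i)))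

  turnCost≡xor : ∀ i → turnCost W i ≡ bit (horizontal i xor horizontal (suc i))
  -- The clauses coincide; matching on the decisions is what lets turnCost W i compute.
  turnCost≡xor i
    with rowOf (pos W i) ≟ rowOf (pos W (suc i)) in e₁ | rowOf (pos W (suc i)) ≟ rowOf (pos W (suc (suc i))) in e₂
  ... | yes _ | yes _ = sym (cong₂ (λ p q → bit (does p xor does q)) e₁ e₂)
  ... | yes _ | no  _ = sym (cong₂ (λ p q → bit (does p xor does q)) e₁ e₂)
  ... | no  _ | yes _ = sym (cong₂ (λ p q → bit (does p xor does q)) e₁ e₂)
  ... | no  _ | no  _ = sym (cong₂ (λ p q → bit (does p xor does q)) e₁ e₂)

  turnCost-perpendicular : ∀ i → horizontal i ≡ not (horizontal (suc i)) → turnCost W i ≡ 1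
  turnCost-perpendicular i hᵢ≡¬hᵢ₊₁ =
    trans (turnCost≡xor i) (cong bit (trans (cong (_xor horizontal (suc i)) hᵢ≡¬hᵢ₊₁) (xor-inverseˡ (horizontal (suc i)))))

  horizontal-periodic : horizontal (len W) ≡ horizontal 0
  horizontal-periodic = cong₂ (λ u v → does (rowOf u ≟ rowOf v)) (periodic W 0) (periodic W 1)

  horizontal-keeps-row : ∀ i → T (horizontal i) → rowOf (pos W (suc i)) ≡ rowOf (pos W i)
  horizontal-keeps-row i hᵢ = sym (≡ᵇ⇒≡ (rowOf (pos W i)) (rowOf (pos W (suc i))) hᵢ)

  vertical-keeps-column : ∀ i → T (not (horizontal i)) → columnOf (pos W (suc i)) ≡ columnOf (pos W i)
  vertical-keeps-column i ¬hᵢ with steps W i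
  ... | inj₁ (row≡ , _) = ⊥-elim (subst (T ∘ not) (dec-true (rowOf (pos W i) ≟ rowOf (pos W (suc i))) row≡) ¬hᵢ)
  ... | inj₂ (col≡ , _) = sym col≡

  link-across-rows⇒turn : ∀ {v c d} → JLink W v c d → rowOf c ≡ rowOf v → rowOf d ≢ rowOf v →
    ∃[ i ] i < len W × pos W (suc i) ≡ v × turnCost W i ≡ 1
  link-across-rows⇒turn (i , i<L , refl , inj₁ (refl , refl)) row≡ row≢ = i , i<L , refl ,
    turnCost-perpendicular i (trans (dec-true (_ ≟ _) row≡) (cong not (sym (dec-false (_ ≟ _) (row≢ ∘ sym)))))
  link-across-rows⇒turn (i , i<L , refl , inj₂ (refl , refl)) row≡ row≢ = i , i<L , refl ,
    turnCost-perpendicular i (trans (dec-false (_ ≟ _) row≢) (cong not (sym (dec-true (_ ≟ _) (sym row≡)))))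

  -- J(v) joins a horizontal edge at v to a vertical one, and the first link of that
  -- path leaving the row of v is a visit of v between perpendicular edges.
  turn-at-every-vertex : 2 ≤ w → 2 ≤ h → (∀ v → JunctionConnected W v) →
    ∀ v → ∃[ i ] i < len W × pos W (suc i) ≡ v × turnCost W i ≡ 1
  turn-at-every-vertex 2≤w 2≤h connected (x , y)
    with x' , x~x' ← adjacent-index 2≤w x | y' , y~y' ← adjacent-index 2≤h y
    with _ , _ , link , row≡ , row≢ ← Star-crossing (λ u → rowOf u ≟ toℕ y)
           (connected (x , y) (x' , y) (x , y') (inj₁ (refl , x~x')) (inj₂ (refl , y~y'))) refl (adjacent-≢ y~y')
    = link-across-rows⇒turn link row≡ row≢

  visited-as-successor : ∀ {i} → i < len W → ∃[ k ] pos W (suc k) ≡ pos W i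
  visited-as-successor {i} i<L with len W | i<L | periodic W i
  ... | suc L′ | _ | per = i + L′ , trans (cong (pos W) (sym (+-suc i L′))) per

  traversed-endpoint-visited : ∀ {i u n} → i < len W → TraversesAt W i u n → ∃[ k ] pos W (suc k) ≡ u
  traversed-endpoint-visited i<L (inj₁ (pos[i]≡u , _)) = map₂ (λ e → trans e pos[i]≡u) (visited-as-successor i<L)
  traversed-endpoint-visited {i} _ (inj₂ (_ , pos[1+i]≡u)) = i , pos[1+i]≡u

  leaf-blocks-threading : ∀ u n → Adj u n → (∀ v → Adj u v → v ≡ n) → CoversAllEdges W → NoUTurns W → ⊥
  leaf-blocks-threading u n u~n only-n covers no-u-turn
    with i , i<L , traversal ← covers u n u~n
    with k , pos[1+k]≡u ← traversed-endpoint-visited i<L traversal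
    = no-u-turn k (trans (neighbour (steps W (suc k))) (sym (neighbour (Adj-sym (steps W k)))))
    where
    neighbour : ∀ {v} → Adj (pos W (suc k)) v → v ≡ n
    neighbour = only-n _ ∘ subst (λ x → Adj x _) pos[1+k]≡u

corner-of-column : ∀ {h} (v : Vertex 1 (2 + h)) → Adj (fzero , fzero) v → v ≡ (fzero , fsuc fzero)
corner-of-column (fzero , y)             (inj₁ (_ , inj₁ ()))
corner-of-column (fzero , y)             (inj₁ (_ , inj₂ ()))
corner-of-column (fzero , fsuc fzero)    (inj₂ (_ , inj₁ refl)) = refl
corner-of-column (fzero , fsuc (fsuc _)) (inj₂ (_ , inj₁ ()))
corner-of-column (fzero , y)             (inj₂ (_ , inj₂ ()))

corner-of-row : ∀ {w} (v : Vertex (2 + w) 1) → Adj (fzero , fzero) v → v ≡ (fsuc fzero , fzero)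
corner-of-row (fsuc fzero , fzero)    (inj₁ (_ , inj₁ refl)) = refl
corner-of-row (fsuc (fsuc _) , fzero) (inj₁ (_ , inj₁ ()))
corner-of-row (x , fzero)             (inj₁ (_ , inj₂ ()))
corner-of-row (x , fzero)             (inj₂ (_ , inj₁ ()))
corner-of-row (x , fzero)             (inj₂ (_ , inj₂ ()))

threading-dimensions : ∀ {w h} (W : ClosedWalk w h) → Threading W → 2 ≤ w × 2 ≤ h
threading-dimensions {zero} W _ with pos W 0
... | () , _
threading-dimensions {suc _} {zero} W _ with pos W 0
... | _ , ()
threading-dimensions {1} {1} W _ with pos W 0 | pos W 1 | steps W 0
... | fzero , fzero | fzero , fzero | inj₁ (_ , inj₁ ())
... | fzero , fzero | fzero , fzero | inj₁ (_ , inj₂ ())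
... | fzero , fzero | fzero , fzero | inj₂ (_ , inj₁ ())
... | fzero , fzero | fzero , fzero | inj₂ (_ , inj₂ ())
threading-dimensions {1} {suc (suc _)} W (covers , no-u-turn , _) =
  ⊥-elim (leaf-blocks-threading W _ _ (inj₂ (refl , inj₁ refl)) corner-of-column covers no-u-turn)
threading-dimensions {suc (suc _)} {1} W (covers , no-u-turn , _) =
  ⊥-elim (leaf-blocks-threading W _ _ (inj₁ (refl , inj₁ refl)) corner-of-row covers no-u-turn)
threading-dimensions {suc (suc _)} {suc (suc _)} W _ = s≤s (s≤s z≤n) , s≤s (s≤s z≤n)

module _ {w h} (W : ClosedWalk w h) (2≤w : 2 ≤ w) (2≤h : 2 ≤ h) (connected : ∀ v → JunctionConnected W v) where

  turn-at-cell : ∀ {x y} → x < w → y < h →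
    ∃[ i ] i < len W × columnOf (pos W (suc i)) ≡ x × rowOf (pos W (suc i)) ≡ y × turnCost W i ≡ 1
  turn-at-cell x<w y<h
    with i , i<L , pos≡ , turn ← turn-at-every-vertex W 2≤w 2≤h connected (fromℕ< x<w , fromℕ< y<h)
    = i , i<L , trans (cong columnOf pos≡) (toℕ-fromℕ< x<w) , trans (cong rowOf pos≡) (toℕ-fromℕ< y<h) , turn

  turns-by-columns : w * (2 * ⌈ h /2⌉) ≤ turns W
  turns-by-columns = turn-count-bound (turnCost W) (columnOf ∘ pos W) (rowOf ∘ pos W) (not ∘ horizontal W)
    (toℕ<n ∘ proj₁ ∘ pos W) (toℕ<n ∘ proj₂ ∘ pos W)
    (λ i → trans (turnCost≡xor W i) (cong bit (sym (not-xor-not (horizontal W i) (horizontal W (suc i))))))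
    (vertical-keeps-column W) (cong not (horizontal-periodic W)) (cong columnOf (periodic W 0))
    (λ _ _ → turn-at-cell)

  turns-by-rows : h * (2 * ⌈ w /2⌉) ≤ turns W
  turns-by-rows = turn-count-bound (turnCost W) (rowOf ∘ pos W) (columnOf ∘ pos W) (horizontal W)
    (toℕ<n ∘ proj₂ ∘ pos W) (toℕ<n ∘ proj₁ ∘ pos W)
    (turnCost≡xor W) (horizontal-keeps-row W) (horizontal-periodic W) (cong rowOf (periodic W 0))
    (λ _ _ y<h x<w → let i , i<L , col , row , turn = turn-at-cell x<w y<h in i , i<L , row , col , turn)

lemma21 : ∀ (w h : ℕ) → (2 ∣ w ⊎ 2 ∣ h) → (W : ClosedWalk w h) → Threading W →
            (2 * ⌈ w /2⌉) * (2 * ⌈ h /2⌉) ≤ turns W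
lemma21 w h even W threading@(_ , _ , connected) with threading-dimensions W threading | even
... | 2≤w , 2≤h | inj₁ 2∣w rewrite 2*⌈n/2⌉≡n 2∣w = turns-by-columns W 2≤w 2≤h connected
... | 2≤w , 2≤h | inj₂ 2∣h rewrite 2*⌈n/2⌉≡n 2∣h =
  subst (_≤ turns W) (*-comm h _) (turns-by-rows W 2≤w 2≤h connected)
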